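{- There exists a $\{K_3,K_4\}$-decomposition of $K_{19}$ consisting of $13$ copies of $K_3$ and $22$ copies of $K_4$. Consequently $D(19,\{3,4\})\le 35$.
   Context: A $\{K_3,K_4\}$-decomposition of $K_v$ is a collection of subgraphs of $K_v$, each isomorphic to $K_3$ or $K_4$, whose edge sets partition $E(K_v)$. $D(v,\{3,4\})$ denotes the minimum number of subgraphs in a $\{K_3,K_4\}$-decomposition of $K_v$. -}

module Defs where

open import Data.Nat using (ℕ; _≤_)
open import Data.Fin using (Fin)
open import Data.List using (List; length; filter)
open import Data.List.Membership.Propositional using (_∈_)
open import Data.List.Relation.Unary.All using (All)
open import Data.List.Relation.Unary.Unique.Propositional using (Unique)
open import Data.List.Membership.DecPropositional using () renaming (_∈?_ to _∈?ᴸ_)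
open import Data.Fin.Properties using (_≟_)
open import Data.Product using (_×_; Σ; ∃)
open import Data.Sum using (_⊎_)
open import Relation.Binary.PropositionalEquality using (_≡_; _≢_)
open import Relation.Nullary using (Dec)
open import Relation.Nullary.Decidable using (_×-dec_)

-- A block on vertex set Fin v is a list of its (distinct) vertices.
-- A block with k distinct vertices represents the complete subgraph K_k
-- of K_v on those vertices.
Block : ℕ → Set
Block v = List (Fin v)

IsK : ∀ {v} → ℕ → Block v → Set
IsK k B = Unique B × length B ≡ k

_∈?edge_ : ∀ {v} (e : Fin v × Fin v) (B : Block v) → Dec (Data.Product.proj₁ e ∈ B × Data.Product.proj₂ e ∈ B)
_∈?edge_ {v} (x Data.Product., y) B = (_∈?ᴸ_ _≟_ x B) ×-dec (_∈?ᴸ_ _≟_ y B)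

edgeMultiplicity : ∀ {v} → Fin v → Fin v → List (Block v) → ℕ
edgeMultiplicity x y 𝓑 = length (filter (λ B → (x Data.Product., y) ∈?edge B) 𝓑)

record IsK34Decomposition (v : ℕ) (𝓑 : List (Block v)) : Set where
  field
    blocks-K3-or-K4 : All (λ B → IsK 3 B ⊎ IsK 4 B) 𝓑
    edges-partitioned : ∀ (x y : Fin v) → x ≢ y → edgeMultiplicity x y 𝓑 ≡ 1

countK : ∀ {v} → ℕ → List (Block v) → ℕ
countK k 𝓑 = length (filter (λ B → length B Data.Nat.≟ k) 𝓑)

-- D(v,{3,4}) ≤ n  :⇔  the minimum size of a {K3,K4}-decomposition of K_v
-- is at most n, i.e. some decomposition has at most n members.
D34≤ : ℕ → ℕ → Set
D34≤ v n = ∃ λ (𝓑 : List (Block v)) → IsK34Decomposition v 𝓑 × length 𝓑 ≤ n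

{-# OPTIONS --safe #-}
-- Split the 18 finite points of K₁₉ into the six triples {3g, 3g+1, 3g+2} and call
-- the last point ∞ = 18. The decomposition is invariant under the permutation σ of
-- order 3 that rotates every triple and fixes ∞: it consists of the σ-orbits of 11
-- base blocks (seven K₄'s, four K₃'s) and the two σ-fixed blocks {12,13,14,∞} and
-- {15,16,17}, giving 7·3 + 1 = 22 copies of K₄ and 4·3 + 1 = 13 copies of K₃.
-- Being a decomposition is decidable, so the 35 blocks are checked by evaluation.
module Submission where

open import Defs
open import Data.Nat using (suc; _+_; _≤_)
import Data.Nat as ℕ
open import Data.Nat.Properties using (≤-refl; +-suc)
open import Data.Fin using (Fin; #_; _↑ˡ_; splitAt; remQuot; combine)
open import Data.Fin.Patterns using (0F; 1F; 2F)
open import Data.Fin.Properties using (_≟_; all?)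
open import Data.List using (List; []; _∷_; length; filter; map; concatMap; _++_)
open import Data.List.Properties using (filter-accept; filter-reject)
open import Data.List.Relation.Unary.All as All using (All; []; _∷_)
open import Data.List.Relation.Unary.Unique.DecPropositional using (unique?)
open import Data.Product using (_×_; ∃; _,_; uncurry)
open import Data.Sum using (_⊎_; inj₁; inj₂)
open import Function using (_∘_)
open import Relation.Binary.PropositionalEquality
  using (_≡_; _≢_; refl; sym; trans; cong; cong₂; subst; module ≡-Reasoning)
open import Relation.Nullary using (Dec; ¬?; _→-dec_)
open import Relation.Nullary.Decidable using (from-yes; map′; _×-dec_; _⊎-dec_)

open IsK34Decomposition

isK? : ∀ {v} k (B : Block v) → Dec (IsK k B)
isK? k B = unique? _≟_ B ×-dec (length B ℕ.≟ k)

isK34Decomposition? : ∀ {v} (𝓑 : List (Block v)) → Dec (IsK34Decomposition v 𝓑)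
isK34Decomposition? 𝓑 =
  map′ (λ (isK34 , partition) → record { blocks-K3-or-K4 = isK34 ; edges-partitioned = partition })
       (λ d → blocks-K3-or-K4 d , edges-partitioned d)
       (All.all? (λ B → isK? 3 B ⊎-dec isK? 4 B) 𝓑
         ×-dec all? (λ x → all? (λ y → ¬? (x ≟ y) →-dec (edgeMultiplicity x y 𝓑 ℕ.≟ 1))))

countK-accept : ∀ {v k} (B : Block v) 𝓑 → length B ≡ k → countK k (B ∷ 𝓑) ≡ suc (countK k 𝓑)
countK-accept {k = k} B 𝓑 |B|≡k = cong length (filter-accept (λ C → length C ℕ.≟ k) {B} {𝓑} |B|≡k)

countK-reject : ∀ {v k} (B : Block v) 𝓑 → length B ≢ k → countK k (B ∷ 𝓑) ≡ countK k 𝓑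
countK-reject {k = k} B 𝓑 |B|≢k = cong length (filter-reject (λ C → length C ℕ.≟ k) {B} {𝓑} |B|≢k)

length≡countK3+countK4 : ∀ {v} {𝓑 : List (Block v)} →
  All (λ B → IsK 3 B ⊎ IsK 4 B) 𝓑 → length 𝓑 ≡ countK 3 𝓑 + countK 4 𝓑
length≡countK3+countK4 [] = refl
length≡countK3+countK4 {𝓑 = B ∷ 𝓑} (inj₁ (_ , |B|≡3) ∷ rest) = begin
  suc (length 𝓑)                        ≡⟨ cong suc (length≡countK3+countK4 rest) ⟩
  suc (countK 3 𝓑) + countK 4 𝓑         ≡⟨ cong₂ _+_ (sym (countK-accept B 𝓑 |B|≡3))
                                                      (sym (countK-reject B 𝓑 ((λ ()) ∘ trans (sym |B|≡3)))) ⟩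
  countK 3 (B ∷ 𝓑) + countK 4 (B ∷ 𝓑)   ∎
  where open ≡-Reasoning
length≡countK3+countK4 {𝓑 = B ∷ 𝓑} (inj₂ (_ , |B|≡4) ∷ rest) = begin
  suc (length 𝓑)                        ≡⟨ cong suc (length≡countK3+countK4 rest) ⟩
  suc (countK 3 𝓑 + countK 4 𝓑)         ≡⟨ sym (+-suc (countK 3 𝓑) (countK 4 𝓑)) ⟩
  countK 3 𝓑 + suc (countK 4 𝓑)         ≡⟨ cong₂ _+_ (sym (countK-reject B 𝓑 ((λ ()) ∘ trans (sym |B|≡4))))
                                                      (sym (countK-accept B 𝓑 |B|≡4)) ⟩
  countK 3 (B ∷ 𝓑) + countK 4 (B ∷ 𝓑)   ∎
  where open ≡-Reasoning

decomposition⇒D34≤ : ∀ {v} {𝓑 : List (Block v)} →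
  IsK34Decomposition v 𝓑 → D34≤ v (countK 3 𝓑 + countK 4 𝓑)
decomposition⇒D34≤ {𝓑 = 𝓑} d =
  𝓑 , d , subst (_≤ countK 3 𝓑 + countK 4 𝓑) (sym (length≡countK3+countK4 (blocks-K3-or-K4 d))) ≤-refl

next : Fin 3 → Fin 3
next 0F = 1F
next 1F = 2F
next 2F = 0F

σ : Fin 19 → Fin 19
σ i with splitAt 18 i
... | inj₁ j = uncurry (λ g r → combine g (next r)) (remQuot {6} 3 j) ↑ˡ 1
... | inj₂ _ = i

orbit : Block 19 → List (Block 19)
orbit B = B ∷ map σ B ∷ map (σ ∘ σ) B ∷ []

baseBlocks : List (Block 19)
baseBlocks =
    (# 0 ∷ # 3 ∷ # 8 ∷ # 18 ∷ [])
  ∷ (# 9 ∷ # 15 ∷ # 18 ∷ [])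
  ∷ (# 0 ∷ # 1 ∷ # 12 ∷ # 15 ∷ [])
  ∷ (# 0 ∷ # 5 ∷ # 9 ∷ # 16 ∷ [])
  ∷ (# 0 ∷ # 4 ∷ # 7 ∷ # 10 ∷ [])
  ∷ (# 0 ∷ # 6 ∷ # 11 ∷ # 13 ∷ [])
  ∷ (# 9 ∷ # 10 ∷ # 13 ∷ [])
  ∷ (# 3 ∷ # 7 ∷ # 11 ∷ # 16 ∷ [])
  ∷ (# 3 ∷ # 4 ∷ # 13 ∷ [])
  ∷ (# 3 ∷ # 14 ∷ # 15 ∷ [])
  ∷ (# 6 ∷ # 7 ∷ # 12 ∷ # 17 ∷ [])
  ∷ []

fixedBlocks : List (Block 19)
fixedBlocks =
    (# 12 ∷ # 13 ∷ # 14 ∷ # 18 ∷ [])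
  ∷ (# 15 ∷ # 16 ∷ # 17 ∷ [])
  ∷ []

blocks : List (Block 19)
blocks = concatMap orbit baseBlocks ++ fixedBlocks

blocks-decomposition : IsK34Decomposition 19 blocks
blocks-decomposition = from-yes (isK34Decomposition? blocks)

lemma28 : (∃ λ (𝓑 : List (Block 19)) →
               IsK34Decomposition 19 𝓑 × countK 3 𝓑 ≡ 13 × countK 4 𝓑 ≡ 22)
            × D34≤ 19 35
lemma28 =
  (blocks , blocks-decomposition , count₃ , count₄) ,
  subst (D34≤ 19) (cong₂ _+_ count₃ count₄) (decomposition⇒D34≤ blocks-decomposition)
  where
  count₃ : countK 3 blocks ≡ 13
  count₃ = refl
  count₄ : countK 4 blocks ≡ 22
  count₄ = refl
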